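{- Let $L$ be a finite distributive lattice, let $\ell\in L$, and let $i$ and $j$ be distinct join irreducible elements of $L$ such that $i\vee\ell\ne\ell$ and $j\vee\ell\ne\ell$. Then $i\vee\ell\ne j\vee\ell$. -}

module Defs where

open import Level using (Level)
open import Data.Nat using (ℕ)
open import Data.Fin using (Fin)
open import Data.Product using (Σ; _×_)
open import Data.Sum using (_⊎_)
open import Relation.Nullary using (¬_)
open import Function.Bundles using (Inverse)
open import Relation.Binary.PropositionalEquality as ≡ using ()
open import Algebra.Lattice.Bundles using (DistributiveLattice)

module _ {c ℓ : Level} (L : DistributiveLattice c ℓ) where
  open DistributiveLattice L

  IsFinite : Set (c Level.⊔ ℓ)
  IsFinite = Σ ℕ λ n → Inverse setoid (≡.setoid (Fin n))

  _≤L_ : Carrier → Carrier → Set ℓ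
  x ≤L y = (x ∨ y) ≈ y

  -- Join irreducible: not the least element (i.e. not the empty join), and
  -- whenever j = a ∨ b then j = a or j = b.
  JoinIrreducible : Carrier → Set (c Level.⊔ ℓ)
  JoinIrreducible j =
    ¬ (∀ x → j ≤L x) × (∀ a b → j ≈ (a ∨ b) → (j ≈ a) ⊎ (j ≈ b))

-- A join irreducible element i of a distributive lattice is join prime:
-- i ≤ a ∨ b forces i ≤ a or i ≤ b, since i = i ∧ (a ∨ b) = (i ∧ a) ∨ (i ∧ b).
-- If i ∨ l = j ∨ l then i ≤ j ∨ l, and i ≰ l leaves i ≤ j; symmetrically
-- j ≤ i, so i = j.
module Submission where

open import Defs
open import Level using (Level)
open import Relation.Nullary using (¬_; contradiction)
open import Algebra.Lattice.Bundles using (DistributiveLattice)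
open import Data.Product using (_,_)
open import Data.Sum using (_⊎_; inj₁; inj₂; map)
open import Algebra.Lattice.Properties.DistributiveLattice using (∨-idem)
import Relation.Binary.Reasoning.Setoid as SetoidReasoning

module _ {c ℓ : Level} (L : DistributiveLattice c ℓ) where
  open DistributiveLattice L
  open SetoidReasoning setoid

  private
    infix 4 _≤_
    _≤_ : Carrier → Carrier → Set ℓ
    _≤_ = _≤L_ L

  ≈-∧⇒≤L : ∀ {x y} → x ≈ x ∧ y → x ≤ y
  ≈-∧⇒≤L {x} {y} x≈x∧y = begin
    x ∨ y       ≈⟨ ∨-congʳ x≈x∧y ⟩
    x ∧ y ∨ y   ≈⟨ ∨-comm _ _ ⟩
    y ∨ x ∧ y   ≈⟨ ∨-congˡ (∧-comm x y) ⟩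
    y ∨ y ∧ x   ≈⟨ ∨-absorbs-∧ y x ⟩
    y           ∎

  ≤L-antisym : ∀ {x y} → x ≤ y → y ≤ x → x ≈ y
  ≤L-antisym {x} {y} x≤y y≤x = begin
    x      ≈⟨ sym y≤x ⟩
    y ∨ x  ≈⟨ ∨-comm y x ⟩
    x ∨ y  ≈⟨ x≤y ⟩
    y      ∎

  ∨-≈⇒≤L : ∀ {x y z} → x ∨ z ≈ y ∨ z → x ≤ y ∨ z
  ∨-≈⇒≤L {x} {y} {z} eq = begin
    x ∨ (y ∨ z)  ≈⟨ ∨-congˡ (sym eq) ⟩
    x ∨ (x ∨ z)  ≈⟨ sym (∨-assoc x x z) ⟩
    (x ∨ x) ∨ z  ≈⟨ ∨-congʳ (∨-idem L x) ⟩
    x ∨ z        ≈⟨ eq ⟩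
    y ∨ z        ∎

  joinIrreducible⇒joinPrime : ∀ {i} → JoinIrreducible L i →
                              ∀ a b → i ≤ a ∨ b → i ≤ a ⊎ i ≤ b
  joinIrreducible⇒joinPrime {i} (_ , irreducible) a b i≤a∨b =
    map ≈-∧⇒≤L ≈-∧⇒≤L (irreducible (i ∧ a) (i ∧ b) i≈i∧a∨i∧b)
    where
    i≈i∧a∨i∧b : i ≈ i ∧ a ∨ i ∧ b
    i≈i∧a∨i∧b = begin
      i                ≈⟨ sym (∧-absorbs-∨ i (a ∨ b)) ⟩
      i ∧ (i ∨ a ∨ b)  ≈⟨ ∧-congˡ i≤a∨b ⟩
      i ∧ (a ∨ b)      ≈⟨ ∧-distribˡ-∨ i a b ⟩
      i ∧ a ∨ i ∧ b    ∎

  joinIrreducible-≤-∨-cancel : ∀ {i} → JoinIrreducible L i →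
                               ∀ {a b} → ¬ i ≤ b → i ≤ a ∨ b → i ≤ a
  joinIrreducible-≤-∨-cancel ji {a} {b} i≰b i≤a∨b
    with joinIrreducible⇒joinPrime ji a b i≤a∨b
  ... | inj₁ i≤a = i≤a
  ... | inj₂ i≤b = contradiction i≤b i≰b

mainTheorem12 : {c ℓ : Level} (L : DistributiveLattice c ℓ) → IsFinite L →
    let open DistributiveLattice L in
    (l i j : Carrier) → JoinIrreducible L i → JoinIrreducible L j → ¬ (i ≈ j) →
    ¬ ((i ∨ l) ≈ l) → ¬ ((j ∨ l) ≈ l) → ¬ ((i ∨ l) ≈ (j ∨ l))
mainTheorem12 L _ l i j ji jj i≉j i≰l j≰l i∨l≈j∨l = i≉j (≤L-antisym L i≤j j≤i)
  where
  open DistributiveLattice L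
  i≤j : _≤L_ L i j
  i≤j = joinIrreducible-≤-∨-cancel L ji i≰l (∨-≈⇒≤L L i∨l≈j∨l)
  j≤i : _≤L_ L j i
  j≤i = joinIrreducible-≤-∨-cancel L jj j≰l (∨-≈⇒≤L L (sym i∨l≈j∨l))
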